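{- Let $\mathcal{C}\subseteq\mathbb{F}_2^m$ be a $(d,t)$-well-behaved linear code with generator matrix $M\in\mathbb{F}_2^{n\times m}$, and let $\Delta=1-d/m$. For any $N\in\mathbb{N}$ with $N\leq m$, if $S$ is distributed uniformly in $\binom{[m]}{N}$, then $\Pr_S[M[S]\text{ is not full rank}]\leq 2^n\Delta^N$.
   Context: A linear code $\mathcal{C}\subseteq\mathbb{F}_2^m$ with generator matrix $M$ means $M\in\mathbb{F}_2^{n\times m}$ has rank $n$ and $\mathcal{C}=\{M^{\mathsf T}w: w\in\mathbb{F}_2^n\}$. The distance $d(\mathcal{C})$ is the minimum number of nonzero coordinates of a nonzero codeword; the dual code is $\mathcal{C}^\perp=\{v\in\mathbb{F}_2^m: Mv=0\}$ and the dual distance is $d^\perp(\mathcal{C})=d(\mathcal{C}^\perp)$. $\mathcal{C}$ is $(d,t)$-well-behaved if $d(\mathcal{C})>d$ and $d^\perp(\mathcal{C})>t$. $M[S]$ is the submatrix of columns indexed by $S$; full rank means rank $n$. $\binom{[m]}{N}$ is the set of $N$-element subsets of $[m]$. -}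

module Defs where

open import Data.Nat using (ℕ; zero; suc; _<_)
open import Data.Bool using (Bool; true; false; _xor_; _∧_)
open import Data.Fin using (Fin; zero; suc)
open import Data.Fin.Subset using (Subset; _∈_; ∣_∣)
open import Data.Vec using (tabulate)
open import Relation.Binary.PropositionalEquality using (_≡_)
open import Relation.Nullary using (¬_)

-- F₂ is Bool with xor as addition and ∧ as multiplication.
-- An n×m matrix over F₂.
Matrix : ℕ → ℕ → Set
Matrix n m = Fin n → Fin m → Bool

Σ₂ : ∀ {k} → (Fin k → Bool) → Bool
Σ₂ {zero}  f = false
Σ₂ {suc k} f = f zero xor Σ₂ (λ i → f (suc i))

IsZero : ∀ {k} → (Fin k → Bool) → Set
IsZero v = ∀ i → v i ≡ false

weight : ∀ {k} → (Fin k → Bool) → ℕ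
weight v = ∣ tabulate v ∣

encode : ∀ {n m} → Matrix n m → (Fin n → Bool) → (Fin m → Bool)
encode M w j = Σ₂ (λ i → w i ∧ M i j)

apply : ∀ {n m} → Matrix n m → (Fin m → Bool) → (Fin n → Bool)
apply M v i = Σ₂ (λ j → M i j ∧ v j)

FullRank : ∀ {n m} → Matrix n m → Set
FullRank M = ∀ w → IsZero (encode M w) → IsZero w

SubFullRank : ∀ {n m} → Matrix n m → Subset m → Set
SubFullRank M S = ∀ w → (∀ j → j ∈ S → encode M w j ≡ false) → IsZero w

DistanceGt : ∀ {n m} → Matrix n m → ℕ → Set
DistanceGt M d = ∀ w → ¬ IsZero (encode M w) → d < weight (encode M w)

DualDistanceGt : ∀ {n m} → Matrix n m → ℕ → Set
DualDistanceGt M t = ∀ v → IsZero (apply M v) → ¬ IsZero v → t < weight v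

WellBehaved : ∀ {n m} → Matrix n m → ℕ → ℕ → Set
WellBehaved M d t = DistanceGt M d × DualDistanceGt M t
  where open import Data.Product using (_×_)

-- If M[S] is rank deficient, some nonzero message w has a codeword Mᵀw vanishing on S, so S lies
-- in the zero set of a nonzero codeword, which has at most m − d elements because d(C) > d.
-- A union bound over the 2ⁿ messages therefore allows at most 2ⁿ · C(m − d, N) such N-sets S,
-- and C(z, N) · m^N ≤ z^N · C(m, N) for z ≤ m (by induction on N, using the absorption identity
-- (k + 1) · C(z, k + 1) = (z − k) · C(z, k)) turns this into 2ⁿ · (m − d)^N · C(m, N).
module Submission where

open import Defs
open import Data.Bool using (Bool; true; false; _xor_; _∧_)
open import Data.Bool.Properties using () renaming (_≟_ to _≟ᵇ_)
open import Data.Fin using (Fin; zero; suc)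
open import Data.Fin.Properties using (all?)
open import Data.Fin.Subset using (Subset; _∈_; _⊆_; ∣_∣; ∁; inside; outside)
open import Data.Fin.Subset.Properties using (_∈?_; drop-∷-⊆; x∉p⇒x∈∁p; ∣∁p∣≡n∸∣p∣)
open import Data.List using (List; []; _∷_; length; filter; map; _++_)
open import Data.List.Properties using (length-++; length-map)
open import Data.List.Relation.Unary.All as All using (All; []; _∷_)
import Data.List.Relation.Unary.All.Properties as All
open import Data.List.Relation.Unary.AllPairs using ([]; _∷_)
open import Data.List.Relation.Unary.Any as Any using (Any; here; any?)
import Data.List.Relation.Unary.Any.Properties as Any
open import Data.List.Relation.Unary.Unique.Propositional using (Unique)
import Data.List.Relation.Unary.Unique.Propositional.Properties as Unique
open import Data.Nat
  using (ℕ; zero; suc; _≤_; _<_; _≤′_; ≤′-refl; ≤′-step; _+_; _*_; _^_; _∸_; z≤n; s≤s)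
open import Data.Nat.Properties
open import Data.Nat.Combinatorics using (_C_; nC1≡n; nCk+nC[k+1]≡[n+1]C[k+1]; k>n⇒nCk≡0)
open import Data.Nat.Solver using (module +-*-Solver)
open import Data.Product as Product using (_×_; _,_; map₂)
open import Data.Vec using ([]; _∷_; here; tabulate)
open import Data.Vec.Properties using ([]=⇒lookup; lookup∘tabulate)
open import Data.Vec.Functional using (head; tail) renaming (_∷_ to _◂_)
open import Function using (_∘_)
open import Relation.Binary.PropositionalEquality
open import Relation.Nullary using (¬_; Dec; yes; no; contradiction; ¬?)
open import Relation.Nullary.Decidable using (_×-dec_; _→-dec_; decidable-stable)

nCk≤[n+1]Ck : ∀ n k → n C k ≤ suc n C k
nCk≤[n+1]Ck n zero    = ≤-refl
nCk≤[n+1]Ck n (suc k) = subst (n C suc k ≤_) (nCk+nC[k+1]≡[n+1]C[k+1] n k) (m≤n+m _ _)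

C-monoˡ-≤ : ∀ k {a b} → a ≤ b → a C k ≤ b C k
C-monoˡ-≤ k {a} a≤b = mono (≤⇒≤′ a≤b)
  where
  mono : ∀ {b} → a ≤′ b → a C k ≤ b C k
  mono ≤′-refl        = ≤-refl
  mono (≤′-step a≤′b) = ≤-trans (mono a≤′b) (nCk≤[n+1]Ck _ k)

nC[k+1]*[k+1]≡nCk*[n∸k] : ∀ n k → (n C suc k) * suc k ≡ (n C k) * (n ∸ k)
nC[k+1]*[k+1]≡nCk*[n∸k] zero    k       = sym (trans (cong ((0 C k) *_) (0∸n≡0 k)) (*-zeroʳ (0 C k)))
nC[k+1]*[k+1]≡nCk*[n∸k] (suc n) zero    = trans (*-identityʳ _) (trans (nC1≡n (suc n)) (sym (+-identityʳ _)))
nC[k+1]*[k+1]≡nCk*[n∸k] (suc n) (suc k) = begin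
  (suc n C (2 + k)) * (2 + k)      ≡⟨ cong (_* (2 + k)) (nCk+nC[k+1]≡[n+1]C[k+1] n (suc k)) ⟨
  (a + b) * (2 + k)                ≡⟨ *-distribʳ-+ (2 + k) a b ⟩
  a * (2 + k) + b * (2 + k)        ≡⟨ cong (a * (2 + k) +_) (nC[k+1]*[k+1]≡nCk*[n∸k] n (suc k)) ⟩
  a * (2 + k) + a * (n ∸ suc k)    ≡⟨ *-distribˡ-+ a (2 + k) (n ∸ suc k) ⟨
  a * (2 + k + (n ∸ suc k))        ≡⟨ regroup ⟩
  a * (suc k + (n ∸ k))            ≡⟨ *-distribˡ-+ a (suc k) (n ∸ k) ⟩
  a * suc k + a * (n ∸ k)          ≡⟨ cong (_+ a * (n ∸ k)) (nC[k+1]*[k+1]≡nCk*[n∸k] n k) ⟩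
  (n C k) * (n ∸ k) + a * (n ∸ k)  ≡⟨ *-distribʳ-+ (n ∸ k) (n C k) a ⟨
  (n C k + a) * (n ∸ k)            ≡⟨ cong (_* (n ∸ k)) (nCk+nC[k+1]≡[n+1]C[k+1] n k) ⟩
  (suc n C suc k) * (n ∸ k)        ∎
  where
  open ≡-Reasoning
  a = n C suc k
  b = n C (2 + k)
  regroup : a * (2 + k + (n ∸ suc k)) ≡ a * (suc k + (n ∸ k))
  regroup with suc k ≤? n
  ... | yes k<n = cong (λ x → a * suc x) (trans (sym (+-suc k (n ∸ suc k))) (cong (k +_) (sym (+-∸-assoc 1 k<n))))
  ... | no  k≮n rewrite k>n⇒nCk≡0 (≰⇒> k≮n) = refl

[z∸k]*m≤z*[m∸k] : ∀ {z m} k → z ≤ m → (z ∸ k) * m ≤ z * (m ∸ k)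
[z∸k]*m≤z*[m∸k] {z} {m} k z≤m = begin
  (z ∸ k) * m    ≡⟨ *-distribʳ-∸ m z k ⟩
  z * m ∸ k * m  ≤⟨ ∸-monoʳ-≤ (z * m) (*-monoʳ-≤ k z≤m) ⟩
  z * m ∸ k * z  ≡⟨ cong (z * m ∸_) (*-comm k z) ⟩
  z * m ∸ z * k  ≡⟨ *-distribˡ-∸ z m k ⟨
  z * (m ∸ k)    ∎
  where open ≤-Reasoning

C*^≤^*C : ∀ k {z m} → z ≤ m → (z C k) * m ^ k ≤ z ^ k * (m C k)
C*^≤^*C zero    z≤m = ≤-refl
C*^≤^*C (suc k) {z} {m} z≤m = *-cancelʳ-≤ _ _ (suc k) (begin
  (z C suc k) * (m * m ^ k) * suc k
    ≡⟨ solve 4 (λ c p x s → c :* (x :* p) :* s := (c :* s) :* (p :* x)) refl (z C suc k) (m ^ k) m (suc k) ⟩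
  (z C suc k) * suc k * (m ^ k * m)
    ≡⟨ cong (_* (m ^ k * m)) (nC[k+1]*[k+1]≡nCk*[n∸k] z k) ⟩
  (z C k) * (z ∸ k) * (m ^ k * m)
    ≡⟨ solve 4 (λ c u p x → c :* u :* (p :* x) := (c :* p) :* (u :* x)) refl (z C k) (z ∸ k) (m ^ k) m ⟩
  (z C k) * m ^ k * ((z ∸ k) * m)
    ≤⟨ *-mono-≤ (C*^≤^*C k z≤m) ([z∸k]*m≤z*[m∸k] k z≤m) ⟩
  z ^ k * (m C k) * (z * (m ∸ k))
    ≡⟨ solve 4 (λ p c x u → p :* c :* (x :* u) := (x :* p) :* (c :* u)) refl (z ^ k) (m C k) z (m ∸ k) ⟩
  z * z ^ k * ((m C k) * (m ∸ k))
    ≡⟨ cong (z * z ^ k *_) (nC[k+1]*[k+1]≡nCk*[n∸k] m k) ⟨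
  z * z ^ k * ((m C suc k) * suc k)
    ≡⟨ *-assoc (z * z ^ k) (m C suc k) (suc k) ⟨
  z * z ^ k * (m C suc k) * suc k
    ∎)
  where
  open ≤-Reasoning
  open +-*-Solver

tailsWith : ∀ {m} → Bool → List (Subset (suc m)) → List (Subset m)
tailsWith b []             = []
tailsWith b ((x ∷ S) ∷ Ss) with x ≟ᵇ b
... | yes _ = S ∷ tailsWith b Ss
... | no  _ = tailsWith b Ss

length-tailsWith : ∀ {m} (Ss : List (Subset (suc m))) →
                   length Ss ≡ length (tailsWith inside Ss) + length (tailsWith outside Ss)
length-tailsWith []                   = refl
length-tailsWith ((inside  ∷ S) ∷ Ss) = cong suc (length-tailsWith Ss)
length-tailsWith ((outside ∷ S) ∷ Ss) = trans (cong suc (length-tailsWith Ss)) (sym (+-suc _ _))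

tailsWith-All⁺ : ∀ {m p} {Q : Subset (suc m) → Set p} b {Ss} → All Q Ss → All (Q ∘ (b ∷_)) (tailsWith b Ss)
tailsWith-All⁺ b {[]}           []       = []
tailsWith-All⁺ b {(x ∷ S) ∷ Ss} (q ∷ qs) with x ≟ᵇ b
... | yes refl = q ∷ tailsWith-All⁺ b qs
... | no  _    = tailsWith-All⁺ b qs

tailsWith-Unique : ∀ {m} b {Ss : List (Subset (suc m))} → Unique Ss → Unique (tailsWith b Ss)
tailsWith-Unique b {[]}           []       = []
tailsWith-Unique b {(x ∷ S) ∷ Ss} (S∉ ∷ u) with x ≟ᵇ b
... | yes refl = All.map (λ S≢T → S≢T ∘ cong (b ∷_)) (tailsWith-All⁺ b S∉) ∷ tailsWith-Unique b u
... | no  _    = tailsWith-Unique b u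

mutual
  length-subsets≤C : ∀ {m} (Z : Subset m) k {Ss : List (Subset m)} → Unique Ss →
                     All (λ S → ∣ S ∣ ≡ k × S ⊆ Z) Ss → length Ss ≤ ∣ Z ∣ C k
  length-subsets≤C []      k {[]}          _               _                = z≤n
  length-subsets≤C []      k {[] ∷ []}     _               ((refl , _) ∷ _) = ≤-refl
  length-subsets≤C []      k {[] ∷ [] ∷ _} ((≢[] ∷ _) ∷ _) _                = contradiction refl ≢[]
  length-subsets≤C (x ∷ Z) k {Ss}          u               Ss⊆              = begin
    length Ss                 ≡⟨ length-tailsWith Ss ⟩
    length ins + length outs  ≤⟨ +-monoʳ-≤ (length ins) outs≤ ⟩
    length ins + ∣ Z ∣ C k    ≤⟨ length-subsets∋zero≤C x Z k (tailsWith-Unique inside u)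
                                                          (tailsWith-All⁺ inside Ss⊆) ⟩
    ∣ x ∷ Z ∣ C k             ∎
    where
    open ≤-Reasoning
    ins  = tailsWith inside Ss
    outs = tailsWith outside Ss
    outs≤ : length outs ≤ ∣ Z ∣ C k
    outs≤ = length-subsets≤C Z k (tailsWith-Unique outside u)
                                 (All.map (map₂ drop-∷-⊆) (tailsWith-All⁺ outside Ss⊆))

  length-subsets∋zero≤C : ∀ {m} x (Z : Subset m) k {Ts : List (Subset m)} → Unique Ts →
                          All (λ T → ∣ inside ∷ T ∣ ≡ k × inside ∷ T ⊆ x ∷ Z) Ts →
                          length Ts + ∣ Z ∣ C k ≤ ∣ x ∷ Z ∣ C k
  length-subsets∋zero≤C outside Z k       {[]}    _ []             = ≤-refl
  length-subsets∋zero≤C outside Z k       {_ ∷ _} _ ((_ , T⊆) ∷ _) = contradiction (T⊆ here) λ ()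
  length-subsets∋zero≤C inside  Z zero    {[]}    _ []             = ≤-refl
  length-subsets∋zero≤C inside  Z (suc k) {Ts}    u Ts⊆            = begin
    length Ts + ∣ Z ∣ C suc k   ≤⟨ +-monoˡ-≤ _ (length-subsets≤C Z k u Ts′) ⟩
    ∣ Z ∣ C k + ∣ Z ∣ C suc k   ≡⟨ nCk+nC[k+1]≡[n+1]C[k+1] ∣ Z ∣ k ⟩
    suc ∣ Z ∣ C suc k           ∎
    where
    open ≤-Reasoning
    Ts′ : All (λ T → ∣ T ∣ ≡ k × T ⊆ Z) Ts
    Ts′ = All.map (Product.map suc-injective drop-∷-⊆) Ts⊆

length≤filter+filter : ∀ {a p} {A : Set a} {P : A → Set p} (P? : ∀ x → Dec (P x)) xs →
                       length xs ≤ length (filter P? xs) + length (filter (¬? ∘ P?) xs)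
length≤filter+filter P? []       = z≤n
length≤filter+filter P? (x ∷ xs) with P? x
... | yes _ = s≤s (length≤filter+filter P? xs)
... | no  _ = ≤-trans (s≤s (length≤filter+filter P? xs)) (≤-reflexive (sym (+-suc _ _)))

union-bound : ∀ {a b p} {A : Set a} {B : Set b} {P : A → B → Set p} (P? : ∀ x y → Dec (P x y)) K →
              (∀ x {ys} → Unique ys → All (P x) ys → length ys ≤ K) →
              ∀ xs {ys} → Unique ys → All (λ y → Any (λ x → P x y) xs) ys → length ys ≤ length xs * K
union-bound P? K fibre≤ []       {[]}    _ _        = z≤n
union-bound P? K fibre≤ []       {_ ∷ _} _ (() ∷ _)
union-bound P? K fibre≤ (x ∷ xs) {ys}    u covered = begin
  length ys                                                        ≤⟨ length≤filter+filter (P? x) ys ⟩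
  length (filter (P? x) ys) + length (filter (¬? ∘ P? x) ys)       ≤⟨ +-mono-≤ hit rest ⟩
  K + length xs * K                                                ∎
  where
  open ≤-Reasoning
  hit : length (filter (P? x) ys) ≤ K
  hit = fibre≤ x (Unique.filter⁺ (P? x) u) (All.all-filter (P? x) ys)
  rest : length (filter (¬? ∘ P? x) ys) ≤ length xs * K
  rest = union-bound P? K fibre≤ xs (Unique.filter⁺ (¬? ∘ P? x) u)
           (All.zipWith (λ (¬Pxy , Py) → Any.tail ¬Pxy Py)
             (All.all-filter (¬? ∘ P? x) ys , All.filter⁺ (¬? ∘ P? x) covered))

allVectors : ∀ n → List (Fin n → Bool)
allVectors zero    = (λ ()) ∷ []
allVectors (suc n) = map (true ◂_) (allVectors n) ++ map (false ◂_) (allVectors n)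

length-allVectors : ∀ n → length (allVectors n) ≡ 2 ^ n
length-allVectors zero    = refl
length-allVectors (suc n) = begin
  length (map (true ◂_) vs ++ map (false ◂_) vs)         ≡⟨ length-++ (map (true ◂_) vs) ⟩
  length (map (true ◂_) vs) + length (map (false ◂_) vs) ≡⟨ cong₂ _+_ (length-map _ vs) (length-map _ vs) ⟩
  length vs + length vs                                  ≡⟨ cong₂ _+_ 2ⁿ (trans 2ⁿ (sym (+-identityʳ _))) ⟩
  2 ^ suc n                                              ∎
  where
  open ≡-Reasoning
  vs = allVectors n
  2ⁿ = length-allVectors n

◂-≗ : ∀ {n b} {v : Fin n → Bool} {w : Fin (suc n) → Bool} → head w ≡ b → v ≗ tail w → (b ◂ v) ≗ w
◂-≗ w₀≡b v≗w zero    = sym w₀≡b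
◂-≗ w₀≡b v≗w (suc i) = v≗w i

allVectors-complete : ∀ {n} (w : Fin n → Bool) → Any (_≗ w) (allVectors n)
allVectors-complete {zero}  w = here λ ()
allVectors-complete {suc n} w with w zero in w₀≡
... | true  = Any.++⁺ˡ (Any.map⁺ (Any.map (◂-≗ w₀≡) (allVectors-complete (tail w))))
... | false = Any.++⁺ʳ _ (Any.map⁺ (Any.map (◂-≗ w₀≡) (allVectors-complete (tail w))))

Σ₂-cong : ∀ {k} {f g : Fin k → Bool} → f ≗ g → Σ₂ f ≡ Σ₂ g
Σ₂-cong {zero}  f≗g = refl
Σ₂-cong {suc k} f≗g = cong₂ _xor_ (f≗g zero) (Σ₂-cong (f≗g ∘ suc))

encode-cong : ∀ {n m} (M : Matrix n m) {v w} → v ≗ w → encode M v ≗ encode M w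
encode-cong M v≗w j = Σ₂-cong (λ i → cong (_∧ M i j) (v≗w i))

IsZero? : ∀ {k} (v : Fin k → Bool) → Dec (IsZero v)
IsZero? v = all? (λ i → v i ≟ᵇ false)

Vanishes : ∀ {m} → (Fin m → Bool) → Subset m → Set
Vanishes c S = ∀ j → j ∈ S → c j ≡ false

Vanishes? : ∀ {m} (c : Fin m → Bool) S → Dec (Vanishes c S)
Vanishes? c S = all? (λ j → (j ∈? S) →-dec (c j ≟ᵇ false))

RankWitness : ∀ {n m} → Matrix n m → Subset m → (Fin n → Bool) → Set
RankWitness M S w = ¬ IsZero w × Vanishes (encode M w) S

RankWitness? : ∀ {n m} (M : Matrix n m) S w → Dec (RankWitness M S w)
RankWitness? M S w = ¬? (IsZero? w) ×-dec Vanishes? (encode M w) S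

rankWitness-search : ∀ {n m} (M : Matrix n m) S → ¬ SubFullRank M S → Any (RankWitness M S) (allVectors n)
rankWitness-search {n} M S ¬full with any? (RankWitness? M S) (allVectors n)
... | yes found = found
... | no  none  = contradiction full ¬full
  where
  full : SubFullRank M S
  full w Mᵀw|S≡0 = decidable-stable (IsZero? w) λ w≢0 → none (Any.map (λ v≗w →
      (λ v≡0 → w≢0 λ i → trans (sym (v≗w i)) (v≡0 i)) ,
      (λ j j∈S → trans (encode-cong M v≗w j) (Mᵀw|S≡0 j j∈S)))
    (allVectors-complete w))

zeros : ∀ {m} → (Fin m → Bool) → Subset m
zeros c = ∁ (tabulate c)

Vanishes⇒⊆zeros : ∀ {m} {c : Fin m → Bool} {S} → Vanishes c S → S ⊆ zeros c
Vanishes⇒⊆zeros {c = c} c|S≡0 {j} j∈S = x∉p⇒x∈∁p λ j∈c →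
  contradiction (trans (sym ([]=⇒lookup j∈c)) (trans (lookup∘tabulate c j) (c|S≡0 j j∈S))) λ ()

∣zeros∣≤m∸d : ∀ {m d} {c : Fin m → Bool} → d < weight c → ∣ zeros c ∣ ≤ m ∸ d
∣zeros∣≤m∸d {m} {d} {c} d<∣c∣ = begin
  ∣ zeros c ∣   ≡⟨ ∣∁p∣≡n∸∣p∣ (tabulate c) ⟩
  m ∸ weight c  ≤⟨ ∸-monoʳ-≤ m (<⇒≤ d<∣c∣) ⟩
  m ∸ d         ∎
  where open ≤-Reasoning

rankWitness-fibre≤ : ∀ {n m d} {M : Matrix n m} → FullRank M → DistanceGt M d →
                     ∀ k w {Ss} → Unique Ss → All (λ S → ∣ S ∣ ≡ k × RankWitness M S w) Ss →
                     length Ss ≤ (m ∸ d) C k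
rankWitness-fibre≤ full far k w {[]} _ _ = z≤n
rankWitness-fibre≤ {m = m} {d} {M} full far k w {Ss@(_ ∷ _)} u witnessed@((_ , w≢0 , _) ∷ _) =
  begin
    length Ss        ≤⟨ length-subsets≤C (zeros c) k u (All.map (map₂ (Vanishes⇒⊆zeros ∘ Product.proj₂)) witnessed) ⟩
    ∣ zeros c ∣ C k  ≤⟨ C-monoˡ-≤ k (∣zeros∣≤m∸d (far w (w≢0 ∘ full w))) ⟩
    (m ∸ d) C k      ∎
  where
  open ≤-Reasoning
  c = encode M w

lemma4p6 : (n m d t : ℕ) (M : Matrix n m) → FullRank M → WellBehaved M d t →
    (N : ℕ) → N ≤ m →
    (L : List (Subset m)) → Unique L →
    All (λ S → (∣ S ∣ ≡ N) × ¬ SubFullRank M S) L →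
    length L * m ^ N ≤ 2 ^ n * (m ∸ d) ^ N * (m C N)
lemma4p6 n m d t M full (far , _) N _ L unique deficient = begin
  length L * m ^ N                 ≤⟨ *-monoˡ-≤ (m ^ N) L≤ ⟩
  2 ^ n * ((m ∸ d) C N) * m ^ N    ≡⟨ *-assoc (2 ^ n) _ _ ⟩
  2 ^ n * (((m ∸ d) C N) * m ^ N)  ≤⟨ *-monoʳ-≤ (2 ^ n) (C*^≤^*C N (m∸n≤m m d)) ⟩
  2 ^ n * ((m ∸ d) ^ N * (m C N))  ≡⟨ *-assoc (2 ^ n) _ _ ⟨
  2 ^ n * (m ∸ d) ^ N * (m C N)    ∎
  where
  open ≤-Reasoning
  covered : All (λ S → Any (λ w → ∣ S ∣ ≡ N × RankWitness M S w) (allVectors n)) L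
  covered = All.map (λ (size , ¬full) → Any.map (size ,_) (rankWitness-search M _ ¬full)) deficient
  L≤ : length L ≤ 2 ^ n * ((m ∸ d) C N)
  L≤ = subst (λ l → length L ≤ l * ((m ∸ d) C N)) (length-allVectors n)
         (union-bound (λ w S → (∣ S ∣ ≟ N) ×-dec RankWitness? M S w) ((m ∸ d) C N)
                      (rankWitness-fibre≤ full far N) (allVectors n) unique covered)
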